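{- Let $A$ be a finite set with at least three elements and let $\eta=\{(a,b)\in A^2\mid a\neq b\}$. Then $\mathrm{PPol}(\eta)=\mathrm{Deg}(A)$.
   Context: $B_n(A)=\mathrm{Sym}(A^n)$, $B(A)=\bigcup_n B_n(A)$. For a relation $R\subseteq A^k$, $\mathrm{PPol}(R)$ is the set of $f\in B_n(A)$ ($n\in\mathbb{N}$) such that for every $k\times n$ array with all columns in $R$, applying $f$ to each row yields an array with all columns in $R$. For $\alpha\in S_n$, $\pi_\alpha(x_1,\dots,x_n)=(x_{\alpha^{ -1}(1)},\dots,x_{\alpha^{ -1}(n)})$. $\mathrm{Deg}(A)=\{\pi_\alpha\bullet(\beta_1\oplus\dots\oplus\beta_n)\mid n\in\mathbb{N},\alpha\in S_n,\beta_i\in\mathrm{Sym}(A)\}$, where $\beta_1\oplus\dots\oplus\beta_n$ acts coordinatewise by $\beta_i$ on the $i$-th coordinate and $\bullet$ is composition; i.e. $\mathrm{Deg}(A)=\bigcup_n \mathrm{Sym}(A)\,\mathrm{wr}\,S_n$ (the degenerate, or essentially unary, permutations). -}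

module Defs where

open import Level using (0ℓ)
open import Data.Nat using (ℕ)
open import Data.Fin using (Fin)
open import Data.Vec using (Vec; lookup; tabulate)
open import Data.Product using (Σ; ∃; _×_)
open import Relation.Binary.PropositionalEquality using (_≡_)
open import Relation.Nullary using (¬_)
open import Function.Bundles using (_↔_; Inverse)

Sym : Set → Set
Sym X = X ↔ X

B : Set → ℕ → Set
B A n = Sym (Vec A n)

apply : {X : Set} → Sym X → X → X
apply σ = Inverse.to σ

η : (A : Set) → A → A → Set
η A a b = ¬ (a ≡ b)

PPol₂ : {A : Set} → (A → A → Set) → {n : ℕ} → B A n → Set
PPol₂ {A} R {n} f =
  (x y : Vec A n) →
  ((i : Fin n) → R (lookup x i) (lookup y i)) →
  (i : Fin n) → R (lookup (apply f x) i) (lookup (apply f y) i)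

-- π_α ∙ (β_1 ⊕ … ⊕ β_n):  x ↦ (β_{α⁻¹(j)}(x_{α⁻¹(j)}))_j
degMap : {A : Set} {n : ℕ} → Sym (Fin n) → (Fin n → Sym A) → Vec A n → Vec A n
degMap α β x =
  tabulate (λ j → apply (β (Inverse.from α j)) (lookup x (Inverse.from α j)))

Deg : {A : Set} {n : ℕ} → B A n → Set
Deg {A} {n} f =
  Σ (Sym (Fin n)) λ α → Σ (Fin n → Sym A) λ β →
    (x : Vec A n) → apply f x ≡ degMap α β x

{-# OPTIONS --safe #-}

-- A permutation f of the finite set A^n that preserves the relation "apart" (different in
-- every coordinate) also reflects it, because some power of f fixes any given pair.  As
-- |A| ≥ 3, w lies coordinatewise between x and y iff every z apart from x and y is apart from
-- w; so f preserves betweenness both ways, and hence also the relation "differ in at most one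
-- coordinate", which holds of u and v iff u and v are the only points between them.  Thus f
-- is an automorphism of the Hamming graph.  Triangles and induced squares of that graph force
-- f to map all lines in a direction i to lines in one direction τ i, with τ injective.  So
-- output coordinate τ i of f depends only on input coordinate i, which is exactly saying that
-- f permutes the coordinates and then permutes A in each of them.

module Submission where

open import Data.Empty using (⊥-elim)
open import Data.Fin using (Fin; zero; suc; toℕ; funToFin; finToFun)
open import Data.Fin.Properties using (pigeonhole; finToFun-funToFin; *↔×; ¬∀⟶∃¬)
  renaming (_≟_ to _≟ᶠ_)
open import Data.Nat using (ℕ; zero; suc; _+_; _*_; _^_; _≤_; s≤s)
open import Data.Nat.GeneralisedArithmetic using (fold; fold-+)
open import Data.Nat.Properties using (n<1+n; m≤n⇒∃[o]m+o≡n; +-suc)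
open import Data.Product using (∃; _×_; _,_; proj₁; proj₂; swap; map₂)
open import Data.Product.Function.NonDependent.Propositional using (_×-↣_)
open import Data.Sum using (_⊎_; inj₁; inj₂; [_,_]′) renaming (map to map-⊎)
open import Data.Vec using (Vec; []; _∷_; lookup; tabulate; replicate; _[_]≔_)
open import Data.Vec.Properties
  using (≡-dec; lookup∘update; lookup∘update′; lookup∘tabulate; []≔-lookup; lookup-replicate)
open import Data.Vec.Relation.Binary.Pointwise.Extensional using (ext; Pointwise-≡⇒≡)
open import Function
  using (_∘_; id; flip; Injective; _↔_; _↣_; _⇔_; Inverse; Injection; mk↣; mk↔ₛ′; mk⇔)
open import Function.Construct.Composition using (_↣-∘_)
open import Function.Properties.Inverse using (↔-sym; ↔⇒↣)
open import Level using (0ℓ)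
open import Relation.Binary.Core using (Rel)
open import Relation.Binary.Definitions using (DecidableEquality)
open import Relation.Binary.PropositionalEquality
open import Relation.Nullary using (yes; no; ¬_)
open import Relation.Nullary.Decidable using (via-injection)

open import Defs

private
  variable
    A X : Set
    m n : ℕ

lookup-ext : {x y : Vec A n} → (∀ i → lookup x i ≡ lookup y i) → x ≡ y
lookup-ext eq = Pointwise-≡⇒≡ (ext eq)

module _ {M : ℕ} (code : X ↣ Fin M) {h : X → X} (h-injective : Injective _≡_ _≡_ h) where

  fold-injective : ∀ k {x y} → fold x h k ≡ fold y h k → x ≡ y
  fold-injective zero    eq = eq
  fold-injective (suc k) eq = fold-injective k (h-injective eq)

  periodic : ∀ x → ∃ λ d → fold x h (suc d) ≡ x
  periodic x with pigeonhole (n<1+n M) (λ t → Injection.to code (fold x h (toℕ t)))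
  ... | i , j , i<j , codes-eq with m≤n⇒∃[o]m+o≡n i<j
  ... | d , i+1+d≡j = d , sym (fold-injective (toℕ i) (begin
    fold x h (toℕ i)                   ≡⟨ Injection.injective code codes-eq ⟩
    fold x h (toℕ j)                   ≡⟨ cong (fold x h) (trans (sym i+1+d≡j) (sym (+-suc _ d))) ⟩
    fold x h (toℕ i + suc d)           ≡⟨ fold-+ x h (toℕ i) ⟩
    fold (fold x h (suc d)) h (toℕ i)  ∎))
    where open ≡-Reasoning

  preimage-closed : (P : X → Set) → (∀ {x} → P x → P (h x)) → ∀ {x} → P (h x) → P x
  preimage-closed P closed {x} Phx with periodic x
  ... | d , hᵈ⁺¹x≡x = subst P hᵈ⁺¹x≡x (iterated d)
    where
    iterated : ∀ k → P (fold x h (suc k))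
    iterated zero    = Phx
    iterated (suc k) = closed (iterated k)

_Preserves_ : (X → X) → Rel X 0ℓ → Set
g Preserves R = ∀ x y → R x y → R (g x) (g y)

IsAutomorphism : Rel X 0ℓ → X ↔ X → Set
IsAutomorphism R f = (Inverse.to f Preserves R) × (Inverse.from f Preserves R)

preserves⇒isAutomorphism : {X : Set} {M : ℕ} → X ↣ Fin M → (R : Rel X 0ℓ) (f : X ↔ X) →
                           Inverse.to f Preserves R → IsAutomorphism R f
preserves⇒isAutomorphism {X} {M} code R f to-preserves = to-preserves , from-preserves
  where
  open Inverse f
  pairCode : (X × X) ↣ Fin (M * M)
  pairCode = ↔⇒↣ (↔-sym *↔×) ↣-∘ (code ×-↣ code)
  to² : X × X → X × X
  to² (x , y) = to x , to y
  to²-injective : Injective _≡_ _≡_ to²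
  to²-injective eq = cong₂ _,_ (Injection.injective (↔⇒↣ f) (cong proj₁ eq))
                               (Injection.injective (↔⇒↣ f) (cong proj₂ eq))
  from-preserves : from Preserves R
  from-preserves x y Rxy =
    preimage-closed pairCode to²-injective (λ (u , v) → R u v) (to-preserves _ _)
      (subst₂ R (sym (strictlyInverseˡ x)) (sym (strictlyInverseˡ y)) Rxy)

Vec↣Fin^ : A ↣ Fin m → Vec A n ↣ Fin (m ^ n)
Vec↣Fin^ {A = A} {m = m} {n = n} code = mk↣ {to = encode} encode-injective
  where
  open Injection code using () renaming (to to c; injective to c-injective)
  encode : Vec A n → Fin (m ^ n)
  encode x = funToFin (c ∘ lookup x)
  encode-injective : Injective _≡_ _≡_ encode
  encode-injective {x} {y} eq = lookup-ext λ i → c-injective (begin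
    c (lookup x i)         ≡⟨ sym (finToFun-funToFin (c ∘ lookup x) i) ⟩
    finToFun (encode x) i  ≡⟨ cong (λ k → finToFun k i) eq ⟩
    finToFun (encode y) i  ≡⟨ finToFun-funToFin (c ∘ lookup y) i ⟩
    c (lookup y i)         ∎)
    where open ≡-Reasoning

module _ {A : Set} where

  private
    variable
      i j k l p q : Fin n
      u v w x y y′ z : Vec A n

  Apart : Vec A n → Vec A n → Set
  Apart x y = ∀ i → lookup x i ≢ lookup y i

  record Between (x w y : Vec A n) : Set where
    constructor between
    field coordinatewise : ∀ i → lookup w i ≡ lookup x i ⊎ lookup w i ≡ lookup y i

  record Near (u v : Vec A n) : Set where
    constructor near
    field unique-difference : lookup u i ≢ lookup v i → lookup u j ≢ lookup v j → i ≡ j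

  -- AgreeExcept i y w says that w lies on the i-line through y.
  record AgreeExcept (p : Fin n) (u v : Vec A n) : Set where
    constructor agreeExcept
    field agree : ∀ i → i ≢ p → lookup u i ≡ lookup v i

  record DependsOnlyOn (g : Vec A n → Vec A n) (j i : Fin n) : Set where
    constructor dependsOnly
    field determined : ∀ x x′ → lookup x i ≡ lookup x′ i → lookup (g x) j ≡ lookup (g x′) j

  open Between
  open Near
  open AgreeExcept
  open DependsOnlyOn

  agreeExcept-sym : AgreeExcept p u v → AgreeExcept p v u
  agreeExcept-sym u≈v = agreeExcept λ i i≢p → sym (agree u≈v i i≢p)

  agreeExcept-trans : AgreeExcept p u v → AgreeExcept p v w → AgreeExcept p u w
  agreeExcept-trans u≈v v≈w =
    agreeExcept λ i i≢p → trans (agree u≈v i i≢p) (agree v≈w i i≢p)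

  agreeExcept-differs⇒≡ : AgreeExcept p u v → lookup u i ≢ lookup v i → i ≡ p
  agreeExcept-differs⇒≡ {p = p} {i = i} u≈v ui≢vi with i ≟ᶠ p
  ... | yes i≡p = i≡p
  ... | no  i≢p = ⊥-elim (ui≢vi (agree u≈v i i≢p))

  agreeExcept-differs : AgreeExcept p u v → u ≢ v → lookup u p ≢ lookup v p
  agreeExcept-differs {p = p} {u = u} {v = v} u≈v u≢v up≡vp = u≢v (lookup-ext agree′)
    where
    agree′ : ∀ i → lookup u i ≡ lookup v i
    agree′ i with i ≟ᶠ p
    ... | yes refl = up≡vp
    ... | no  i≢p  = agree u≈v i i≢p

  agreeExcept⇒near : AgreeExcept p u v → Near u v
  agreeExcept⇒near u≈v = near λ di dj →
    trans (agreeExcept-differs⇒≡ u≈v di) (sym (agreeExcept-differs⇒≡ u≈v dj))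

  corner-not-near : l ≢ i → AgreeExcept l x y → x ≢ y → AgreeExcept i y z → y ≢ z →
                    ¬ Near x z
  corner-not-near {l = l} {i = i} {x = x} {z = z} l≢i x≈y x≢y y≈z y≢z x~z =
    l≢i (unique-difference x~z xl≢zl xi≢zi)
    where
    xl≢zl : lookup x l ≢ lookup z l
    xl≢zl xl≡zl = agreeExcept-differs x≈y x≢y (trans xl≡zl (sym (agree y≈z l l≢i)))
    xi≢zi : lookup x i ≢ lookup z i
    xi≢zi xi≡zi = agreeExcept-differs y≈z y≢z (trans (sym (agree x≈y i (l≢i ∘ sym))) xi≡zi)

  update-agreeExcept : (y : Vec A n) (i : Fin n) (a : A) → AgreeExcept i y (y [ i ]≔ a)
  update-agreeExcept y i a = agreeExcept λ j j≢i → sym (lookup∘update′ j≢i y a)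

  agreeExcept-update : (i : Fin n) (a : A) → AgreeExcept l u v →
                       AgreeExcept l (u [ i ]≔ a) (v [ i ]≔ a)
  agreeExcept-update {l = l} {u = u} {v = v} i a u≈v = agreeExcept agree′
    where
    agree′ : ∀ j → j ≢ l → lookup (u [ i ]≔ a) j ≡ lookup (v [ i ]≔ a) j
    agree′ j j≢l with j ≟ᶠ i
    ... | yes refl = trans (lookup∘update j u a) (sym (lookup∘update j v a))
    ... | no  j≢i  = trans (lookup∘update′ j≢i u a)
                           (trans (agree u≈v j j≢l) (sym (lookup∘update′ j≢i v a)))

  update-≢ : {a : A} → a ≢ lookup y i → y ≢ y [ i ]≔ a
  update-≢ {y = y} {i = i} {a = a} a≢yi y≡y′ =
    a≢yi (trans (sym (lookup∘update i y a)) (cong (λ v → lookup v i) (sym y≡y′)))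

  update-between : (u v : Vec A n) (k : Fin n) → Between u (u [ k ]≔ lookup v k) v
  update-between {n = n} u v k = between choice
    where
    t : Vec A n
    t = u [ k ]≔ lookup v k
    choice : ∀ j → lookup t j ≡ lookup u j ⊎ lookup t j ≡ lookup v j
    choice j with j ≟ᶠ k
    ... | yes refl = inj₂ (lookup∘update j u _)
    ... | no  j≢k  = inj₁ (lookup∘update′ j≢k u _)

  between⇒apart : Between x w y → ∀ z → Apart z x → Apart z y → Apart z w
  between⇒apart w∈xy z z#x z#y i zi≡wi with coordinatewise w∈xy i
  ... | inj₁ wi≡xi = z#x i (trans zi≡wi wi≡xi)
  ... | inj₂ wi≡yi = z#y i (trans zi≡wi wi≡yi)

  endpoints⇒near : (∀ t → Between u t v → t ≡ u ⊎ t ≡ v) → Near u v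
  endpoints⇒near {u = u} {v = v} endpoints = near unique
    where
    unique : lookup u k ≢ lookup v k → lookup u l ≢ lookup v l → k ≡ l
    unique {k = k} {l = l} uk≢vk ul≢vl with k ≟ᶠ l
    ... | yes k≡l = k≡l
    ... | no  k≢l with endpoints (u [ k ]≔ lookup v k) (update-between u v k)
    ...   | inj₁ t≡u = ⊥-elim (uk≢vk (trans (sym (cong (λ t → lookup t k) t≡u))
                                            (lookup∘update k u _)))
    ...   | inj₂ t≡v = ⊥-elim (ul≢vl (trans (sym (lookup∘update′ (k≢l ∘ sym) u _))
                                            (cong (λ t → lookup t l) t≡v)))

  update-connected : (Q : Vec A n → Set) (x′ : Vec A n) →
                     (∀ z l → Q z → Q (z [ l ]≔ lookup x′ l)) → ∀ x → Q x → Q x′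
  update-connected Q []        step []      Qx = Qx
  update-connected Q (a′ ∷ x′) step (a ∷ x) Qx =
    update-connected (λ z → Q (a′ ∷ z)) x′ (λ z l → step (a′ ∷ z) (suc l))
                     x (step (a ∷ x) zero Qx)

  line-connected : (Q : Vec A n → Set) → (∀ {l z z′} → AgreeExcept l z z′ → Q z → Q z′) →
                   Q x → Q y
  line-connected {x = x} {y = y} Q step =
    update-connected Q y (λ z l → step (update-agreeExcept z l _)) x

  slice-connected : (Q : Vec A n → Set) (i : Fin n) →
                    (∀ {l z z′} → l ≢ i → AgreeExcept l z z′ → Q z → Q z′) →
                    lookup x i ≡ lookup y i → Q x → Q y
  slice-connected {n = n} {x = x} {y = y} Q i step xi≡yi Qx =
    proj₂ (update-connected Q′ y step′ x (xi≡yi , Qx))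
    where
    Q′ : Vec A n → Set
    Q′ z = lookup z i ≡ lookup y i × Q z
    step′ : ∀ z l → Q′ z → Q′ (z [ l ]≔ lookup y l)
    step′ z l (zi≡yi , Qz) with l ≟ᶠ i
    ... | yes refl =
      subst Q′ (sym (trans (cong (z [ l ]≔_) (sym zi≡yi)) ([]≔-lookup z l))) (zi≡yi , Qz)
    ... | no  l≢i  = trans (sym (agree (update-agreeExcept z l _) i (l≢i ∘ sym))) zi≡yi ,
                     step l≢i (update-agreeExcept z l _) Qz

  slices⇒dependsOnlyOn : {g : Vec A n → Vec A n} →
                         (∀ {l z z′} → l ≢ i → AgreeExcept l z z′ →
                                       lookup (g z) j ≡ lookup (g z′) j) →
                         DependsOnlyOn g j i
  slices⇒dependsOnlyOn {i = i} {j = j} {g = g} step = dependsOnly λ x x′ xi≡x′i →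
    slice-connected (λ z → lookup (g x) j ≡ lookup (g z) j) i
                    (λ l≢i z≈z′ eq → trans eq (step l≢i z≈z′)) xi≡x′i refl

  dependsOnlyOn-∘ : {g h : Vec A n → Vec A n} →
                    DependsOnlyOn h k j → DependsOnlyOn g l k → DependsOnlyOn (g ∘ h) l j
  dependsOnlyOn-∘ h-dep g-dep =
    dependsOnly λ x x′ → determined g-dep _ _ ∘ determined h-dep x x′

  dependsOnlyOn-replicate : {g : Vec A n → Vec A n} → DependsOnlyOn g j i →
                            ∀ x → lookup (g (replicate n (lookup x i))) j ≡ lookup (g x) j
  dependsOnlyOn-replicate {i = i} dep x = determined dep _ x (lookup-replicate i _)

  dependsOnlyOn-replicate-inverse :
    {g h : Vec A n → Vec A n} → DependsOnlyOn g j i → (∀ x → g (h x) ≡ x) →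
    ∀ a → lookup (g (replicate n (lookup (h (replicate n a)) i))) j ≡ a
  dependsOnlyOn-replicate-inverse {n = n} {j = j} {g = g} {h = h} dep g∘h≗id a = begin
    lookup (g (replicate n (lookup (h (replicate n a)) _))) j  ≡⟨ dependsOnlyOn-replicate dep _ ⟩
    lookup (g (h (replicate n a))) j                           ≡⟨ cong (flip lookup j) (g∘h≗id _) ⟩
    lookup (replicate n a) j                                   ≡⟨ lookup-replicate j a ⟩
    a                                                          ∎
    where open ≡-Reasoning

  module _ (_≟_ : DecidableEquality A) where

    differsAt : u ≢ v → ∃ λ p → lookup u p ≢ lookup v p
    differsAt {u = u} {v = v} u≢v =
      ¬∀⟶∃¬ _ _ (λ p → lookup u p ≟ lookup v p) (u≢v ∘ lookup-ext)

    near⇒agreeExcept : Near u v → lookup u p ≢ lookup v p → AgreeExcept p u v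
    near⇒agreeExcept {u = u} {v = v} {p = p} u~v up≢vp = agreeExcept agree′
      where
      agree′ : ∀ i → i ≢ p → lookup u i ≡ lookup v i
      agree′ i i≢p with lookup u i ≟ lookup v i
      ... | yes ui≡vi = ui≡vi
      ... | no  ui≢vi = ⊥-elim (i≢p (unique-difference u~v ui≢vi up≢vp))

    triangle : AgreeExcept p u v → lookup u p ≢ lookup v p → Near u w → Near v w →
               AgreeExcept p u w
    triangle {p = p} {u = u} {v = v} {w = w} u≈v up≢vp u~w v~w = agreeExcept agree′
      where
      agree′ : ∀ k → k ≢ p → lookup u k ≡ lookup w k
      agree′ k k≢p with lookup u k ≟ lookup w k
      ... | yes uk≡wk = uk≡wk
      ... | no  uk≢wk = ⊥-elim (k≢p (unique-difference v~w vk≢wk vp≢wp))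
        where
        vk≢wk : lookup v k ≢ lookup w k
        vk≢wk vk≡wk = uk≢wk (trans (agree u≈v k k≢p) vk≡wk)
        vp≢wp : lookup v p ≢ lookup w p
        vp≢wp vp≡wp =
          up≢vp (trans (agree (near⇒agreeExcept u~w uk≢wk) p (k≢p ∘ sym)) (sym vp≡wp))

    -- Were v and w to differ off p, w would agree with y at p, hence lie on the p-line through y.
    square : AgreeExcept p y u → lookup y p ≢ lookup u p → AgreeExcept q y v → q ≢ p →
             Near u w → Near v w → ¬ Near y w → AgreeExcept p v w
    square {p = p} {y = y} {u = u} {v = v} {w = w} y≈u yp≢up y≈v q≢p u~w v~w y≁w =
      agreeExcept agree′
      where
      agree′ : ∀ k → k ≢ p → lookup v k ≡ lookup w k
      agree′ k k≢p with lookup v k ≟ lookup w k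
      ... | yes vk≡wk = vk≡wk
      ... | no  vk≢wk = ⊥-elim (y≁w (agreeExcept⇒near (agreeExcept-trans y≈u u≈w)))
        where
        yp≡wp : lookup y p ≡ lookup w p
        yp≡wp = trans (agree y≈v p (q≢p ∘ sym))
                      (agree (near⇒agreeExcept v~w vk≢wk) p (k≢p ∘ sym))
        u≈w : AgreeExcept p u w
        u≈w = near⇒agreeExcept u~w λ up≡wp → yp≢up (trans yp≡wp (sym up≡wp))

    near⇒endpoints : Near u v → Between u w v → w ≡ u ⊎ w ≡ v
    near⇒endpoints {u = u} {v = v} {w = t} u~v t∈uv with ≡-dec _≟_ t u
    ... | yes t≡u = inj₁ t≡u
    ... | no  t≢u with differsAt t≢u
    ... | k , tk≢uk = inj₂ (lookup-ext t≗v)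
      where
      tk≡vk : lookup t k ≡ lookup v k
      tk≡vk = [ ⊥-elim ∘ tk≢uk , id ]′ (coordinatewise t∈uv k)
      t≗v : ∀ l → lookup t l ≡ lookup v l
      t≗v l with lookup u l ≟ lookup v l
      ... | yes ul≡vl = [ (λ tl≡ul → trans tl≡ul ul≡vl) , id ]′ (coordinatewise t∈uv l)
      ... | no  ul≢vl with unique-difference u~v ul≢vl (tk≢uk ∘ trans tk≡vk ∘ sym)
      ...   | refl = tk≡vk

    avoiding : {c₀ c₁ c₂ : A} → c₀ ≢ c₁ → c₀ ≢ c₂ → c₁ ≢ c₂ →
               (b : A) → ∃ λ c → c ≢ c₀ × c ≢ b
    avoiding {c₁ = c₁} c₀≢c₁ c₀≢c₂ c₁≢c₂ b with c₁ ≟ b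
    ... | yes refl = _ , c₀≢c₂ ∘ sym , c₁≢c₂ ∘ sym
    ... | no  c₁≢b = c₁ , c₀≢c₁ ∘ sym , c₁≢b

    fresh-of-three : {c₀ c₁ c₂ : A} → c₀ ≢ c₁ → c₀ ≢ c₂ → c₁ ≢ c₂ →
                     (a b : A) → ∃ λ c → c ≢ a × c ≢ b
    fresh-of-three {c₀} c₀≢c₁ c₀≢c₂ c₁≢c₂ a b with c₀ ≟ a | c₀ ≟ b
    ... | yes refl | _        = avoiding c₀≢c₁ c₀≢c₂ c₁≢c₂ b
    ... | no  _    | yes refl = map₂ swap (avoiding c₀≢c₁ c₀≢c₂ c₁≢c₂ a)
    ... | no  c₀≢a | no  c₀≢b = c₀ , c₀≢a , c₀≢b

    module _ (fresh : (a b : A) → ∃ λ c → c ≢ a × c ≢ b) where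

      apart⇒between : {x w y : Vec A n} → (∀ z → Apart z x → Apart z y → Apart z w) →
                      Between x w y
      apart⇒between {n = n} {x = x} {w = w} {y = y} apart-closed = between choice
        where
        choice : ∀ i → lookup w i ≡ lookup x i ⊎ lookup w i ≡ lookup y i
        choice i with lookup w i ≟ lookup x i | lookup w i ≟ lookup y i
        ... | yes wi≡xi | _         = inj₁ wi≡xi
        ... | no  _     | yes wi≡yi = inj₂ wi≡yi
        ... | no  wi≢xi | no  wi≢yi =
          ⊥-elim (apart-closed t (proj₁ ∘ t#xy) (proj₂ ∘ t#xy) i (lookup∘update i t₀ _))
          where
          Avoids : Fin n → A → Set
          Avoids j a = a ≢ lookup x j × a ≢ lookup y j
          t₀ t : Vec A n
          t₀ = tabulate λ j → proj₁ (fresh (lookup x j) (lookup y j))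
          t  = t₀ [ i ]≔ lookup w i
          t#xy : ∀ j → Avoids j (lookup t j)
          t#xy j with j ≟ᶠ i
          ... | yes refl = subst (Avoids j) (sym (lookup∘update j t₀ _)) (wi≢xi , wi≢yi)
          ... | no  j≢i  = subst (Avoids j)
                                 (sym (trans (lookup∘update′ j≢i t₀ _) (lookup∘tabulate _ j)))
                                 (proj₂ (fresh (lookup x j) (lookup y j)))

      apartAut⇒between-preserving : (f : Vec A n ↔ Vec A n) → IsAutomorphism Apart f →
                                    Between x w y →
                                    Between (Inverse.to f x) (Inverse.to f w) (Inverse.to f y)
      apartAut⇒between-preserving {x = x} {w = w} {y = y} f (to# , from#) w∈xy =
        apart⇒between λ z z#fx z#fy →
          subst (λ z → Apart z (to w)) (strictlyInverseˡ z)
                (to# _ _ (between⇒apart w∈xy (from z) (pull-back z x z#fx)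
                                                      (pull-back z y z#fy)))
        where
        open Inverse f
        pull-back : ∀ z u → Apart z (to u) → Apart (from z) u
        pull-back z u z#fu = subst (Apart (from z)) (strictlyInverseʳ u) (from# _ _ z#fu)

      apartAut⇒nearAut : (f : Vec A n ↔ Vec A n) → IsAutomorphism Apart f →
                         IsAutomorphism Near f
      apartAut⇒nearAut f aut = to-preserves f aut , to-preserves (↔-sym f) (swap aut)
        where
        to-preserves : (g : Vec A n ↔ Vec A n) → IsAutomorphism Apart g →
                       Inverse.to g Preserves Near
        to-preserves g aut u v u~v = endpoints⇒near λ t t∈gu,gv →
          map-⊎ push-forward push-forward
            (near⇒endpoints u~v
              (subst₂ (λ u v → Between u (from t) v) (strictlyInverseʳ u) (strictlyInverseʳ v)
                      (apartAut⇒between-preserving (↔-sym g) (swap aut) t∈gu,gv)))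
          where
          open Inverse g
          push-forward : ∀ {t x} → from t ≡ x → t ≡ to x
          push-forward {t} eq = trans (sym (strictlyInverseˡ t)) (cong to eq)

    module _ {a₀ a₁ : A} (a₀≢a₁ : a₀ ≢ a₁) where

      other : (a : A) → ∃ λ b → b ≢ a
      other a with a₀ ≟ a
      ... | yes refl = a₁ , a₀≢a₁ ∘ sym
      ... | no  a₀≢a = a₀ , a₀≢a

      neighbour : (y : Vec A n) (i : Fin n) → ∃ λ w → AgreeExcept i y w × y ≢ w
      neighbour y i with other (lookup y i)
      ... | a , a≢yi = y [ i ]≔ a , update-agreeExcept y i a , update-≢ a≢yi

      module _ (f : Vec A n ↔ Vec A n) (aut : IsAutomorphism Near f) where
        open Inverse f using (to; strictlyInverseʳ)

        private
          to-≢ : u ≢ v → to u ≢ to v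
          to-≢ u≢v = u≢v ∘ Injection.injective (↔⇒↣ f)

          to-near : AgreeExcept p u v → Near (to u) (to v)
          to-near = proj₁ aut _ _ ∘ agreeExcept⇒near

          near-reflected : Near (to u) (to v) → Near u v
          near-reflected {u = u} {v = v} =
            subst₂ Near (strictlyInverseʳ u) (strictlyInverseʳ v) ∘ proj₂ aut _ _

        MapsLine : Vec A n → Fin n → Fin n → Set
        MapsLine y i p = ∀ {w} → AgreeExcept i y w → AgreeExcept p (to y) (to w)

        edge⇒mapsLine : AgreeExcept i y w → y ≢ w → AgreeExcept p (to y) (to w) →
                        MapsLine y i p
        edge⇒mapsLine y≈w y≢w fy≈fw y≈w′ =
          triangle fy≈fw (agreeExcept-differs fy≈fw (to-≢ y≢w))
                   (to-near y≈w′) (to-near (agreeExcept-trans (agreeExcept-sym y≈w) y≈w′))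

        mapsLine-exists : (y : Vec A n) (i : Fin n) → ∃ (MapsLine y i)
        mapsLine-exists y i with neighbour y i
        ... | w , y≈w , y≢w with differsAt (to-≢ y≢w)
        ... | p , differ = p , edge⇒mapsLine y≈w y≢w (near⇒agreeExcept (to-near y≈w) differ)

        mapsLine-injective : MapsLine y l q → MapsLine y i p → l ≢ i → q ≢ p
        mapsLine-injective {y = y} {l = l} {i = i} maps-l maps-i l≢i refl
          with neighbour y l | neighbour y i
        ... | u , y≈u , y≢u | v , y≈v , y≢v =
          corner-not-near l≢i (agreeExcept-sym y≈u) (y≢u ∘ sym) y≈v y≢v
            (near-reflected (agreeExcept⇒near
              (agreeExcept-trans (agreeExcept-sym (maps-l y≈u)) (maps-i y≈v))))

        mapsLine-across : l ≢ i → AgreeExcept l y y′ → MapsLine y i p → MapsLine y′ i p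
        mapsLine-across {l = l} {i = i} {y = y} {y′ = y′} {p = p} l≢i y≈y′ maps
          with ≡-dec _≟_ y y′
        ... | yes refl = maps
        ... | no  y≢y′ = edge⇒mapsLine y′≈w′ (update-≢ a≢y′i)
            (square fy≈fw (agreeExcept-differs fy≈fw (to-≢ (update-≢ a≢yi)))
                    (maps-l y≈y′) (mapsLine-injective maps-l maps l≢i)
                    (to-near (agreeExcept-update i a y≈y′)) (to-near y′≈w′)
                    (corner-not-near l≢i y≈y′ y≢y′ y′≈w′ (update-≢ a≢y′i) ∘ near-reflected))
          where
          a : A
          a = proj₁ (other (lookup y i))
          a≢yi : a ≢ lookup y i
          a≢yi = proj₂ (other (lookup y i))
          a≢y′i : a ≢ lookup y′ i
          a≢y′i a≡y′i = a≢yi (trans a≡y′i (sym (agree y≈y′ i (l≢i ∘ sym))))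
          y′≈w′ : AgreeExcept i y′ (y′ [ i ]≔ a)
          y′≈w′ = update-agreeExcept y′ i a
          fy≈fw : AgreeExcept p (to y) (to (y [ i ]≔ a))
          fy≈fw = maps (update-agreeExcept y i a)
          maps-l : MapsLine y l (proj₁ (mapsLine-exists y l))
          maps-l = proj₂ (mapsLine-exists y l)

        mapsLine-invariant : AgreeExcept l y y′ → MapsLine y i p → MapsLine y′ i p
        mapsLine-invariant {l = l} {i = i} y≈y′ maps with l ≟ᶠ i
        ... | no  l≢i  = mapsLine-across l≢i y≈y′ maps
        ... | yes refl = λ y′≈w → agreeExcept-trans (agreeExcept-sym (maps y≈y′))
                                                     (maps (agreeExcept-trans y≈y′ y′≈w))

        nearAut⇒coordinatewise : (i : Fin n) → ∃ λ j → DependsOnlyOn to j i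
        nearAut⇒coordinatewise i with mapsLine-exists (replicate _ a₀) i
        ... | j , maps = j , slices⇒dependsOnlyOn λ {l} {z} l≢i z≈z′ →
          let maps-l = proj₂ (mapsLine-exists z l)
          in agree (maps-l z≈z′) j (mapsLine-injective maps-l (everywhere z) l≢i ∘ sym)
          where
          everywhere : ∀ y → MapsLine y i j
          everywhere y = line-connected (λ z → MapsLine z i j) mapsLine-invariant maps

      identity-dependsOnlyOn⇒≡ : {g : Vec A n → Vec A n} → (∀ x → g x ≡ x) →
                                 DependsOnlyOn g k j → k ≡ j
      identity-dependsOnlyOn⇒≡ {n = n} {k = k} {j = j} {g = g} g≗id dep with k ≟ᶠ j
      ... | yes k≡j = k≡j
      ... | no  k≢j = ⊥-elim (a₀≢a₁ (begin
        a₀              ≡⟨ sym (lookup-replicate k a₀) ⟩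
        lookup r k      ≡⟨ cong (λ v → lookup v k) (sym (g≗id r)) ⟩
        lookup (g r) k  ≡⟨ determined dep r r′ (sym (lookup∘update′ (k≢j ∘ sym) r a₁)) ⟩
        lookup (g r′) k ≡⟨ cong (λ v → lookup v k) (g≗id r′) ⟩
        lookup r′ k     ≡⟨ lookup∘update k r a₁ ⟩
        a₁              ∎))
        where
        open ≡-Reasoning
        r r′ : Vec A n
        r  = replicate n a₀
        r′ = r [ k ]≔ a₁

      coordinatewise⇒Deg : (f : B A n) →
                           (∀ i → ∃ λ j → DependsOnlyOn (Inverse.to f) j i) →
                           (∀ j → ∃ λ i → DependsOnlyOn (Inverse.from f) i j) → Deg f
      coordinatewise⇒Deg {n = n} f to-dep from-dep = α , β , λ x → lookup-ext (to≗degMap x)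
        where
        open Inverse f
        τ τ⁻¹ : Fin n → Fin n
        τ   = proj₁ ∘ to-dep
        τ⁻¹ = proj₁ ∘ from-dep
        to-τ : ∀ i → DependsOnlyOn to (τ i) i
        to-τ = proj₂ ∘ to-dep
        τ∘τ⁻¹ : ∀ j → τ (τ⁻¹ j) ≡ j
        τ∘τ⁻¹ j = identity-dependsOnlyOn⇒≡ strictlyInverseˡ
                    (dependsOnlyOn-∘ (proj₂ (from-dep j)) (to-τ (τ⁻¹ j)))
        τ⁻¹∘τ : ∀ i → τ⁻¹ (τ i) ≡ i
        τ⁻¹∘τ i = identity-dependsOnlyOn⇒≡ strictlyInverseʳ
                    (dependsOnlyOn-∘ (to-τ i) (proj₂ (from-dep (τ i))))
        from-τ : ∀ i → DependsOnlyOn from i (τ i)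
        from-τ i = subst (λ k → DependsOnlyOn from k (τ i)) (τ⁻¹∘τ i) (proj₂ (from-dep (τ i)))
        α : Sym (Fin n)
        α = mk↔ₛ′ τ τ⁻¹ τ∘τ⁻¹ τ⁻¹∘τ
        β : Fin n → Sym A
        β i = mk↔ₛ′ (λ a → lookup (to (replicate n a)) (τ i))
                    (λ b → lookup (from (replicate n b)) i)
                    (dependsOnlyOn-replicate-inverse (to-τ i) strictlyInverseˡ)
                    (dependsOnlyOn-replicate-inverse (from-τ i) strictlyInverseʳ)
        to≗degMap : ∀ x j → lookup (to x) j ≡ lookup (degMap α β x) j
        to≗degMap x j = begin
          lookup (to x) j                       ≡⟨ cong (lookup (to x)) (sym (τ∘τ⁻¹ j)) ⟩
          lookup (to x) (τ (τ⁻¹ j))             ≡⟨ dependsOnlyOn-replicate (to-τ (τ⁻¹ j)) x ⟨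
          apply (β (τ⁻¹ j)) (lookup x (τ⁻¹ j))  ≡⟨ lookup∘tabulate _ j ⟨
          lookup (degMap α β x) j               ∎
          where open ≡-Reasoning

Deg⇒PPol : (f : B A n) → Deg f → PPol₂ (η A) f
Deg⇒PPol {n = n} f (α , β , f≗degMap) x y x#y j fxj≡fyj =
  x#y k (Injection.injective (↔⇒↣ (β k)) (begin
    apply (β k) (lookup x k)  ≡⟨ lookup∘tabulate _ j ⟨
    lookup (degMap α β x) j   ≡⟨ cong (flip lookup j) (f≗degMap x) ⟨
    lookup (apply f x) j      ≡⟨ fxj≡fyj ⟩
    lookup (apply f y) j      ≡⟨ cong (flip lookup j) (f≗degMap y) ⟩
    lookup (degMap α β y) j   ≡⟨ lookup∘tabulate _ j ⟩
    apply (β k) (lookup y k)  ∎))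
  where
  open ≡-Reasoning
  k : Fin n
  k = Inverse.from α j

theorem7 : (A : Set) (m : ℕ) → 3 ≤ m → A ↔ Fin m →
    (n : ℕ) (f : B A n) → PPol₂ (η A) f ⇔ Deg f
theorem7 A m (s≤s (s≤s (s≤s _))) A↔Fin n f = mk⇔ PPol⇒Deg (Deg⇒PPol f)
  where
  A↣Fin : A ↣ Fin m
  A↣Fin = ↔⇒↣ A↔Fin
  _≟_ : DecidableEquality A
  _≟_ = via-injection A↣Fin _≟ᶠ_
  e : Fin m → A
  e = Inverse.from A↔Fin
  e-≢ : {i j : Fin m} → i ≢ j → e i ≢ e j
  e-≢ i≢j = i≢j ∘ Injection.injective (↔⇒↣ (↔-sym A↔Fin))
  e₀≢e₁ : e zero ≢ e (suc zero)
  e₀≢e₁ = e-≢ λ ()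
  fresh : (a b : A) → ∃ λ c → c ≢ a × c ≢ b
  fresh = fresh-of-three _≟_ e₀≢e₁ (e-≢ λ ()) (e-≢ {suc zero} {suc (suc zero)} λ ())
  PPol⇒Deg : PPol₂ (η A) f → Deg f
  PPol⇒Deg f-apart = coordinatewise⇒Deg _≟_ e₀≢e₁ f
                       (nearAut⇒coordinatewise _≟_ e₀≢e₁ f near-aut)
                       (nearAut⇒coordinatewise _≟_ e₀≢e₁ (↔-sym f) (swap near-aut))
    where
    apart-aut : IsAutomorphism Apart f
    apart-aut = preserves⇒isAutomorphism (Vec↣Fin^ A↣Fin) Apart f f-apart
    near-aut : IsAutomorphism Near f
    near-aut = apartAut⇒nearAut _≟_ fresh f apart-aut
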